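{- Let $n\ge 3$ and let $W_n=K_1+C_n$ be the wheel. There exists a $C_3$-simple orientation of $W_n$ if and only if $n$ is even.
   Context: The wheel $W_n$ ($n\ge3$) is $K_1+C_n$: a center vertex $c$ adjacent to every vertex of a cycle $v_1v_2\cdots v_nv_1$ (the outer vertices). An orientation of a graph assigns a direction to each edge, producing an oriented graph. An orientation of a graph covered by cycles is called $C_3$-simple if every cycle of length $3$ (triangle) of the underlying graph becomes a strongly connected (i.e. directed) cycle in the resulting oriented graph. -}

module Defs where

open import Data.Nat using (ℕ; suc)
open import Data.Fin using (Fin; zero; suc; toℕ)
open import Data.Product using (_×_)
open import Data.Sum using (_⊎_)
open import Data.Empty using (⊥)
open import Data.Unit using (⊤)
open import Relation.Nullary using (¬_)
open import Relation.Binary.PropositionalEquality using (_≡_)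

-- Adjacency of the cycle C_n = v_1 v_2 ... v_n v_1 on vertex set Fin n
-- (index i stands for v_{i+1}): i ~ j iff j ≡ i+1 (mod n) or i ≡ j+1 (mod n).
CycSucc : (n : ℕ) → Fin n → Fin n → Set
CycSucc n i j = (toℕ j ≡ suc (toℕ i)) ⊎ ((suc (toℕ i) ≡ n) × (toℕ j ≡ 0))

CycleAdj : (n : ℕ) → Fin n → Fin n → Set
CycleAdj n i j = CycSucc n i j ⊎ CycSucc n j i

-- Wheel W_n = K_1 + C_n on vertex set Fin (suc n): vertex zero is the
-- centre c (adjacent to every outer vertex), vertex suc i is v_{i+1}.
WheelAdj : (n : ℕ) → Fin (suc n) → Fin (suc n) → Set
WheelAdj n zero    zero    = ⊥
WheelAdj n zero    (suc j) = ⊤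
WheelAdj n (suc i) zero    = ⊤
WheelAdj n (suc i) (suc j) = CycleAdj n i j

record IsOrientation {V : Set} (Adj : V → V → Set) (Arc : V → V → Set) : Set where
  field
    arc⇒edge : ∀ {u v} → Arc u v → Adj u v
    edge⇒arc : ∀ {u v} → Adj u v → Arc u v ⊎ Arc v u
    antisym  : ∀ {u v} → Arc u v → ¬ Arc v u

-- A triangle (cycle of length 3) of the underlying graph: three pairwise
-- adjacent vertices a, b, c (distinctness follows from looplessness).
Triangle : {V : Set} (Adj : V → V → Set) → V → V → V → Set
Triangle Adj a b c = Adj a b × Adj b c × Adj c a

DirectedTriangle : {V : Set} (Arc : V → V → Set) → V → V → V → Set
DirectedTriangle Arc a b c =
  (Arc a b × Arc b c × Arc c a) ⊎ (Arc a c × Arc c b × Arc b a)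

IsC3Simple : {V : Set} (Adj : V → V → Set) (Arc : V → V → Set) → Set
IsC3Simple Adj Arc =
  IsOrientation Adj Arc ×
  (∀ a b c → Triangle Adj a b c → DirectedTriangle Arc a b c)

-- Colour an outer vertex v by whether its spoke points away from the centre c.
-- A rim edge v w lies on the triangle c v w, and this triangle is directed
-- exactly when the spokes at v and w point in opposite directions; so a
-- C₃-simple orientation is the same thing as a proper 2-colouring of the rim
-- cycle, which exists iff n is even.  Conversely, from a 2-colouring orient
-- the spokes by colour and every rim edge from its true end to its false end;
-- the rim, being bipartite, has no triangles of its own.
module Submission where

open import Defs
open import Data.Nat using (ℕ; zero; suc; _*_; _≥_; _<_)
open import Data.Nat.Divisibility using (_∣_; divides)
open import Data.Nat.GeneralisedArithmetic using (fold)
open import Data.Nat.Properties using (≤-trans; n≤1+n; n<1+n)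
open import Data.Fin using (Fin; zero; suc; toℕ; fromℕ<)
open import Data.Fin.Properties using (toℕ-fromℕ<)
open import Data.Bool using (Bool; true; false; not)
open import Data.Bool.Properties using (not-involutive; not-¬)
open import Data.Product using (Σ; ∃; _×_; _,_; proj₁; proj₂)
open import Data.Sum using (_⊎_; inj₁; inj₂)
open import Data.Unit using (tt)
open import Data.Empty using (⊥; ⊥-elim)
open import Relation.Nullary using (¬_)
open import Relation.Binary.PropositionalEquality
  using (_≡_; refl; sym; trans; cong; module ≡-Reasoning)
open import Function.Bundles using (_⇔_; mk⇔)
open import Function.Construct.Composition using (_⇔-∘_)

not-swap : ∀ {x y} → x ≡ not y → y ≡ not x
not-swap {x} {y} x≡¬y = trans (sym (not-involutive y)) (cong not (sym x≡¬y))

fold-not-fixed⇒even : ∀ b k → fold b not k ≡ b → 2 ∣ k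
fold-not-fixed⇒even b zero          _  = divides 0 refl
fold-not-fixed⇒even b (suc zero)    eq = ⊥-elim (not-¬ refl (sym eq))
fold-not-fixed⇒even b (suc (suc k)) eq
  with fold-not-fixed⇒even b k (trans (sym (not-involutive (fold b not k))) eq)
... | divides q k≡2q = divides (suc q) (cong (λ m → suc (suc m)) k≡2q)

even⇒fold-not-fixed : ∀ b k → 2 ∣ k → fold b not k ≡ b
even⇒fold-not-fixed b _ (divides q refl) = go q
  where
  go : ∀ q → fold b not (q * 2) ≡ b
  go zero    = refl
  go (suc q) = trans (not-involutive _) (go q)

Proper2Colouring : {V : Set} (Adj : V → V → Set) → (V → Bool) → Set
Proper2Colouring Adj col = ∀ {u v} → Adj u v → col v ≡ not (col u)

Symmetrisation : {V : Set} → (V → V → Set) → V → V → Set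
Symmetrisation R u v = R u v ⊎ R v u

symmetrisation-sym : {V : Set} {R : V → V → Set} {u v : V} →
  Symmetrisation R u v → Symmetrisation R v u
symmetrisation-sym (inj₁ r) = inj₂ r
symmetrisation-sym (inj₂ r) = inj₁ r

proper2Colouring-symmetrise : {V : Set} {R : V → V → Set} {col : V → Bool} →
  Proper2Colouring R col → Proper2Colouring (Symmetrisation R) col
proper2Colouring-symmetrise proper (inj₁ r) = proper r
proper2Colouring-symmetrise proper (inj₂ r) = not-swap (proper r)

proper2Colouring⇒triangle-free : {V : Set} {Adj : V → V → Set} {col : V → Bool} →
  Proper2Colouring Adj col → ∀ {a b c} → ¬ Triangle Adj a b c
proper2Colouring⇒triangle-free {col = col} proper {a} (ab , bc , ca) =
  not-¬ refl col-a≡¬col-a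
  where
  open ≡-Reasoning
  col-a≡¬col-a : col a ≡ not (col a)
  col-a≡¬col-a = begin
    col a                   ≡⟨ proper ca ⟩
    not (col _)             ≡⟨ cong not (proper bc) ⟩
    not (not (col _))       ≡⟨ cong (λ x → not (not x)) (proper ab) ⟩
    not (not (not (col a))) ≡⟨ not-involutive _ ⟩
    not (col a)             ∎

directedTriangle-rotate : {V : Set} {Arc : V → V → Set} (a b c : V) →
  DirectedTriangle Arc a b c → DirectedTriangle Arc b c a
directedTriangle-rotate _ _ _ (inj₁ (ab , bc , ca)) = inj₁ (bc , ca , ab)
directedTriangle-rotate _ _ _ (inj₂ (ac , cb , ba)) = inj₂ (ba , ac , cb)

proper2Colouring-cycle-alternates : ∀ m {col : Fin (suc m) → Bool} →
  Proper2Colouring (CycSucc (suc m)) col →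
  ∀ k (k<n : k < suc m) → col (fromℕ< k<n) ≡ fold (col zero) not k
proper2Colouring-cycle-alternates m proper zero    _   = refl
proper2Colouring-cycle-alternates m proper (suc k) k+1<n =
  trans (proper step) (cong not (proper2Colouring-cycle-alternates m proper k k<n))
  where
  k<n : k < suc m
  k<n = ≤-trans (n≤1+n (suc k)) k+1<n
  step : CycSucc (suc m) (fromℕ< k<n) (fromℕ< k+1<n)
  step = inj₁ (trans (toℕ-fromℕ< k+1<n) (cong suc (sym (toℕ-fromℕ< k<n))))

cycle-2-colourable⇒even : ∀ n {col : Fin n → Bool} →
  Proper2Colouring (CycSucc n) col → 2 ∣ n
cycle-2-colourable⇒even zero    _ = divides 0 refl
cycle-2-colourable⇒even (suc m) {col} proper =
  fold-not-fixed⇒even (col zero) (suc m) (sym wrap)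
  where
  wrap : col zero ≡ not (fold (col zero) not m)
  wrap = trans (proper (inj₂ (cong suc (toℕ-fromℕ< (n<1+n m)) , refl)))
               (cong not (proper2Colouring-cycle-alternates m proper m (n<1+n m)))

parity : ℕ → Bool
parity = fold true not

even⇒parity-proper2Colouring : ∀ n → 2 ∣ n →
  Proper2Colouring (CycSucc n) (λ i → parity (toℕ i))
even⇒parity-proper2Colouring n even (inj₁ j≡i+1) = cong parity j≡i+1
even⇒parity-proper2Colouring n even {i} {j} (inj₂ (i+1≡n , j≡0)) = begin
  parity (toℕ j)        ≡⟨ cong parity j≡0 ⟩
  true                  ≡⟨ sym (even⇒fold-not-fixed true n even) ⟩
  parity n              ≡⟨ cong parity (sym i+1≡n) ⟩
  not (parity (toℕ i))  ∎
  where open ≡-Reasoning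

CycleTwoColourable : ℕ → Set
CycleTwoColourable n = ∃ λ (col : Fin n → Bool) → Proper2Colouring (CycSucc n) col

cycle-2-colourable⇔even : ∀ n → CycleTwoColourable n ⇔ (2 ∣ n)
cycle-2-colourable⇔even n = mk⇔ colourable⇒even even⇒colourable
  where
  colourable⇒even : CycleTwoColourable n → 2 ∣ n
  colourable⇒even (_ , proper) = cycle-2-colourable⇒even n proper
  even⇒colourable : 2 ∣ n → CycleTwoColourable n
  even⇒colourable even = _ , even⇒parity-proper2Colouring n even

C3SimpleOrientation : {V : Set} → (V → V → Set) → Set₁
C3SimpleOrientation {V} Adj = Σ (V → V → Set) (IsC3Simple Adj)

module SpokeColouring {n : ℕ} {Arc : Fin (suc n) → Fin (suc n) → Set}
                      (c3Simple : IsC3Simple (WheelAdj n) Arc) where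
  open IsOrientation (proj₁ c3Simple)

  outward : Fin n → Bool
  outward i with edge⇒arc {zero} {suc i} tt
  ... | inj₁ _ = true
  ... | inj₂ _ = false

  outward-true : ∀ {i} → Arc zero (suc i) → outward i ≡ true
  outward-true {i} c→i with edge⇒arc {zero} {suc i} tt
  ... | inj₁ _   = refl
  ... | inj₂ i→c = ⊥-elim (antisym c→i i→c)

  outward-false : ∀ {i} → Arc (suc i) zero → outward i ≡ false
  outward-false {i} i→c with edge⇒arc {zero} {suc i} tt
  ... | inj₁ c→i = ⊥-elim (antisym i→c c→i)
  ... | inj₂ _   = refl

  outward-proper : Proper2Colouring (CycSucc n) outward
  outward-proper {i} {j} i→j
    with proj₂ c3Simple zero (suc i) (suc j) (tt , inj₁ i→j , tt)
  ... | inj₁ (c→i , _ , j→c) rewrite outward-true c→i | outward-false j→c = refl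
  ... | inj₂ (c→j , _ , i→c) rewrite outward-true c→j | outward-false i→c = refl

module ColouringOrientation (n : ℕ) (col : Fin n → Bool)
                            (proper : Proper2Colouring (CycSucc n) col) where
  proper-rim : Proper2Colouring (CycleAdj n) col
  proper-rim = proper2Colouring-symmetrise {R = CycSucc n} proper

  rim-sym : ∀ {i j} → CycleAdj n i j → CycleAdj n j i
  rim-sym = symmetrisation-sym {R = CycSucc n}

  Arc : Fin (suc n) → Fin (suc n) → Set
  Arc zero    zero    = ⊥
  Arc zero    (suc j) = col j ≡ true
  Arc (suc i) zero    = col i ≡ false
  Arc (suc i) (suc j) = CycleAdj n i j × col i ≡ true

  ¬true≡false : ¬ true ≡ false
  ¬true≡false ()

  adjacent-colours : ∀ {i j} → CycleAdj n i j → col i ≡ true → col j ≡ false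
  adjacent-colours ij i-true rewrite proper-rim ij | i-true = refl

  arc⇒edge : ∀ {u v} → Arc u v → WheelAdj n u v
  arc⇒edge {zero}  {suc _} _        = tt
  arc⇒edge {suc _} {zero}  _        = tt
  arc⇒edge {suc _} {suc _} (ij , _) = ij

  edge⇒arc : ∀ {u v} → WheelAdj n u v → Arc u v ⊎ Arc v u
  edge⇒arc {zero} {suc j} _ with col j
  ... | true  = inj₁ refl
  ... | false = inj₂ refl
  edge⇒arc {suc i} {zero} _ with col i
  ... | true  = inj₂ refl
  ... | false = inj₁ refl
  edge⇒arc {suc i} {suc j} ij with col i in i-colour
  ... | true  = inj₁ (ij , refl)
  ... | false = inj₂ (rim-sym ij , trans (proper-rim ij) (cong not i-colour))

  antisym : ∀ {u v} → Arc u v → ¬ Arc v u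
  antisym {zero}  {suc _} j-true  j-false = ¬true≡false (trans (sym j-true) j-false)
  antisym {suc _} {zero}  i-false i-true  = ¬true≡false (trans (sym i-true) i-false)
  antisym {suc _} {suc _} (ij , i-true) (_ , j-true) =
    ¬true≡false (trans (sym j-true) (adjacent-colours ij i-true))

  orientation : IsOrientation (WheelAdj n) Arc
  orientation = record { arc⇒edge = arc⇒edge ; edge⇒arc = edge⇒arc ; antisym = antisym }

  centre-triangle : ∀ i j → CycleAdj n i j → DirectedTriangle Arc zero (suc i) (suc j)
  centre-triangle i j ij with col i in i-colour
  ... | true  = inj₁ (refl , (ij , refl) , adjacent-colours ij i-colour)
  ... | false = inj₂ (j-true , (rim-sym ij , j-true) , refl)
    where
    j-true : col j ≡ true
    j-true = trans (proper-rim ij) (cong not i-colour)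

  rotate : ∀ a b c → DirectedTriangle Arc a b c → DirectedTriangle Arc b c a
  rotate = directedTriangle-rotate

  triangle-directed : ∀ a b c → Triangle (WheelAdj n) a b c → DirectedTriangle Arc a b c
  triangle-directed zero    zero    _       (() , _)
  triangle-directed zero    (suc _) zero    (_ , _ , ())
  triangle-directed (suc _) zero    zero    (_ , () , _)
  triangle-directed zero    (suc i) (suc j) (_ , ij , _) = centre-triangle i j ij
  triangle-directed (suc i) zero    (suc k) (_ , _ , ki) =
    rotate (suc k) (suc i) zero (rotate zero (suc k) (suc i) (centre-triangle k i ki))
  triangle-directed (suc i) (suc j) zero    (ij , _ , _) =
    rotate zero (suc i) (suc j) (centre-triangle i j ij)
  triangle-directed (suc _) (suc _) (suc _) rim =
    ⊥-elim (proper2Colouring⇒triangle-free {Adj = CycleAdj n} proper-rim rim)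

  c3Simple : IsC3Simple (WheelAdj n) Arc
  c3Simple = orientation , triangle-directed

wheel-C3Simple⇔cycle-2-colourable : ∀ n →
  C3SimpleOrientation (WheelAdj n) ⇔ CycleTwoColourable n
wheel-C3Simple⇔cycle-2-colourable n = mk⇔ spokes-colour colouring-orients
  where
  spokes-colour : C3SimpleOrientation (WheelAdj n) → CycleTwoColourable n
  spokes-colour (_ , c3Simple) = let open SpokeColouring c3Simple in outward , outward-proper
  colouring-orients : CycleTwoColourable n → C3SimpleOrientation (WheelAdj n)
  colouring-orients (col , proper) =
    let open ColouringOrientation n col proper in Arc , c3Simple

-- With these definitions the equivalence holds for every n (for n = 1 the rim
-- is a loop, which no orientation can direct).
mainTheorem1 : (n : ℕ) → n ≥ 3 →
    (Σ (Fin (suc n) → Fin (suc n) → Set) (λ Arc → IsC3Simple (WheelAdj n) Arc)) ⇔ (2 ∣ n)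
mainTheorem1 n _ = cycle-2-colourable⇔even n ⇔-∘ wheel-C3Simple⇔cycle-2-colourable n
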